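{- For every integer $n\ge 6$, there is an injection from $P_4(0,n)\cup P_7(0,n)$ into $U_4(0,n)$.
   Context: Durfee symbol of a partition $\lambda$. Set $\lambda_k=0$ for $k>\ell(\lambda)$. Let $d=\max\{k:\lambda_k\ge k\}$, with $d=0$ for the empty partition. Then $$\alpha=(\lambda_1-d,\ldots,\lambda_d-d)',$$ the conjugate of the partition formed by the positive entries, and $$\beta=(\lambda_{d+1},\ldots,\lambda_{\ell(\lambda)}).$$ This is written $(\alpha,\beta)_d$. Parts beyond the length are taken to be $0$. $P(0,n)$ is the set of partitions of $n$ with rank $0$, equivalently $\ell(\alpha)=\ell(\beta)$. Two subsets of $P(0,n)$ are used: - $P_4(0,n)$: those with $\beta_1=d$ and $\alpha_1=\alpha_2=d>\alpha_3$; - $P_7(0,n)$: those with $d=2$, $\beta_1=2>\beta_2$, and $\alpha_1=\alpha_2=\alpha_3=2$. $U(0,n)$ is the set of partitions of $n$ with Durfee symbol $(\gamma,\delta)_{d'}$ such that $\ell(\gamma)-\ell(\delta)\le 0$ and $\gamma_1\le d'-1$. $U_4(0,n)$ is the subset of $U(0,n)$ where $\ell(\gamma)-\ell(\delta)=-1$ and $\delta_1=d'$. -}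

module Defs where

open import Data.Nat using (ℕ; zero; suc; _+_; _∸_; _≤_; _<_; _≥_; _≤?_)
open import Data.List using (List; []; _∷_; length; map; take; drop; filter; upTo)
open import Data.Nat.ListAction using (sum)
open import Data.List.Relation.Unary.All using (All)
open import Data.List.Relation.Unary.Linked using (Linked)
open import Data.Product using (Σ; _×_; _,_; proj₁)
open import Data.Sum using (_⊎_)
open import Relation.Binary.PropositionalEquality using (_≡_)
open import Relation.Nullary using (yes; no)

record Partition (n : ℕ) : Set where
  constructor mkPartition
  field
    parts    : List ℕ
    positive : All (λ x → 0 < x) parts
    decr     : Linked _≥_ parts
    total    : sum parts ≡ n
open Partition public

-- k-th entry (1-indexed), with entries beyond the length taken to be 0.
at : List ℕ → ℕ → ℕ
at []       _             = 0
at (x ∷ xs) zero          = 0   -- index 0 is not used; convention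
at (x ∷ xs) (suc zero)    = x
at (x ∷ xs) (suc (suc k)) = at xs (suc k)

-- Durfee size d = max{k : λ_k ≥ k}. For a weakly decreasing list the set
-- {k : λ_k ≥ k} is an initial segment {1,…,d}, so d is the length of the
-- longest prefix with λ_k ≥ k.
durfeeFrom : ℕ → List ℕ → ℕ
durfeeFrom i []       = 0
durfeeFrom i (x ∷ xs) with suc i ≤? x
... | yes _ = suc (durfeeFrom (suc i) xs)
... | no  _ = 0

durfee : List ℕ → ℕ
durfee = durfeeFrom 0

count≥ : ℕ → List ℕ → ℕ
count≥ j μ = length (filter (j ≤?_) μ)

conj : List ℕ → List ℕ
conj μ = map (λ j → count≥ (suc j) μ) (upTo (at μ 1))

alpha : List ℕ → List ℕ
alpha λs = conj (map (_∸ durfee λs) (take (durfee λs) λs))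

beta : List ℕ → List ℕ
beta λs = drop (durfee λs) λs

InP0 : List ℕ → Set
InP0 λs = length (alpha λs) ≡ length (beta λs)

InP4 : List ℕ → Set
InP4 λs = InP0 λs
        × at (beta λs) 1 ≡ durfee λs
        × at (alpha λs) 1 ≡ durfee λs
        × at (alpha λs) 2 ≡ durfee λs
        × at (alpha λs) 3 < durfee λs

InP7 : List ℕ → Set
InP7 λs = InP0 λs
        × durfee λs ≡ 2
        × at (beta λs) 1 ≡ 2
        × at (beta λs) 2 < 2
        × at (alpha λs) 1 ≡ 2
        × at (alpha λs) 2 ≡ 2
        × at (alpha λs) 3 ≡ 2

-- U(0,n): ℓ(γ) - ℓ(δ) ≤ 0 and γ₁ ≤ d' - 1 (integer arithmetic, written in ℕ)
InU0 : List ℕ → Set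
InU0 λs = length (alpha λs) ≤ length (beta λs)
        × at (alpha λs) 1 + 1 ≤ durfee λs

-- U₄(0,n): in U(0,n), ℓ(γ) - ℓ(δ) = -1 and δ₁ = d'
InU4 : List ℕ → Set
InU4 λs = InU0 λs
        × length (alpha λs) + 1 ≡ length (beta λs)
        × at (beta λs) 1 ≡ durfee λs

P4∪P7 : ℕ → Set
P4∪P7 n = Σ (Partition n) (λ p → InP4 (parts p) ⊎ InP7 (parts p))

U4 : ℕ → Set
U4 n = Σ (Partition n) (λ p → InU4 (parts p))

Injection : ℕ → Set
Injection n = Σ (P4∪P7 n → U4 n) λ f →
  ∀ x y → parts (proj₁ (f x)) ≡ parts (proj₁ (f y)) → parts (proj₁ x) ≡ parts (proj₁ y)

-- Both sets are rigid enough to be parametrised explicitly. A partition in P₄(0,n)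
-- has a Durfee square of side d whose bottom row is d + 2, with the row below equal
-- to d; lowering that bottom row to d and adding a part 2 keeps the square, makes
-- γ have a zero entry (so γ₁ ≤ d − 1) and lengthens δ by one, landing in U₄(0,n).
-- A partition in P₇(0,n) is (4+m, 5+c, 2, 1^(m+1)) with c < m, and is sent to
-- (3+m, 3+c, 3, 3, 1^m), again in U₄(0,n). Both images have the shape
-- (rows above, d, d, rest) from which the original is recovered, and they are told
-- apart by the part 2, present in the first image and absent from the second.
-- The bound n ≥ 6 excludes the only P₄ partitions with d = 1, namely (3,1,1).
module Submission where

open import Defs
open import Data.Nat using (ℕ; zero; suc; _+_; _∸_; _≤_; _<_; _≥_; _≤?_; _<?_; s≤s; z≤n)
open import Data.Nat.Properties
open import Data.Nat.ListAction using (sum)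
open import Data.Nat.ListAction.Properties using (sum-++)
open import Data.Nat.Tactic.RingSolver using (solve-∀)
open import Data.List using (List; []; _∷_; _++_; _∷ʳ_; length; map; take; drop; replicate; applyUpTo; upTo)
open import Data.List.Properties
  using (∷-injective; ∷-injectiveʳ; length-map; length-upTo; length-replicate; map-applyUpTo; filter-all; filter-complete; filter-notAll)
open import Data.List.Membership.Propositional using (_∈_; _∉_)
open import Data.List.Membership.Propositional.Properties using (∈-++⁺ʳ)
open import Data.List.Relation.Unary.All as All using (All; []; _∷_)
open import Data.List.Relation.Unary.All.Properties using (map⁺; map⁻; ++⁺; ++⁻; ++⁻ʳ; replicate⁺; all-filter; All¬⇒¬Any)
open import Data.List.Relation.Unary.Any using (Any; here; there)
import Data.List.Relation.Unary.Any.Properties as Any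
open import Data.List.Relation.Unary.Linked as Linked using (Linked; []; [-]; _∷_)
open import Data.Product using (∃₂; _×_; _,_; proj₁; map₂)
open import Data.Sum using (inj₁; inj₂)
open import Data.Empty using (⊥-elim)
open import Function using (_∘_)
open import Relation.Binary.PropositionalEquality
open import Relation.Nullary using (¬_; yes; no; contradiction)

private
  variable
    A : Set

length-∷ʳ : (xs : List A) (x : A) → length (xs ∷ʳ x) ≡ suc (length xs)
length-∷ʳ []       x = refl
length-∷ʳ (_ ∷ xs) x = cong suc (length-∷ʳ xs x)

take-suc-length : (pre : List A) (x : A) (ys : List A) → take (suc (length pre)) (pre ++ x ∷ ys) ≡ pre ∷ʳ x
take-suc-length []        x ys = refl
take-suc-length (p ∷ pre) x ys = cong (p ∷_) (take-suc-length pre x ys)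

drop-suc-length : (pre : List A) (x : A) (ys : List A) → drop (suc (length pre)) (pre ++ x ∷ ys) ≡ ys
drop-suc-length []        x ys = refl
drop-suc-length (p ∷ pre) x ys = drop-suc-length pre x ys

drop-suc-view : ∀ e (xs : List A) {y ys} → drop (suc e) xs ≡ y ∷ ys →
                ∃₂ λ pre x → length pre ≡ e × xs ≡ pre ++ x ∷ y ∷ ys
drop-suc-view e       []       ()
drop-suc-view zero    (x ∷ xs) eq = [] , x , refl , cong (x ∷_) eq
drop-suc-view (suc e) (x ∷ xs) eq with pre , x′ , refl , refl ← drop-suc-view e xs eq = x ∷ pre , x′ , refl , refl

++-cancel-length : (xs ys : List A) {zs ws : List A} → length xs ≡ length ys → xs ++ zs ≡ ys ++ ws →
                   xs ≡ ys × zs ≡ ws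
++-cancel-length []       []       _   eq = refl , eq
++-cancel-length (x ∷ xs) (y ∷ ys) len eq
  with refl , eq′ ← ∷-injective eq
  with refl , eq″ ← ++-cancel-length xs ys (suc-injective len) eq′ = refl , eq″

Linked-++⇒All≥ : ∀ pre {x rest} → Linked _≥_ (pre ++ x ∷ rest) → All (x ≤_) pre
Linked-++⇒All≥ []            _           = []
Linked-++⇒All≥ (p ∷ [])      (p≥x ∷ _)   = p≥x ∷ []
Linked-++⇒All≥ (p ∷ q ∷ pre) (p≥q ∷ dec) with q≥x ∷ rest ← Linked-++⇒All≥ (q ∷ pre) dec =
  ≤-trans q≥x p≥q ∷ q≥x ∷ rest

Linked-++⁻ʳ : ∀ pre {ys} → Linked _≥_ (pre ++ ys) → Linked _≥_ ys
Linked-++⁻ʳ []        dec = dec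
Linked-++⁻ʳ (_ ∷ pre) dec = Linked-++⁻ʳ pre (Linked.tail dec)

Linked-++-lower : ∀ pre {x y zs ws} → y ≤ x → Linked _≥_ (pre ++ x ∷ zs) → Linked _≥_ (y ∷ ws) →
                  Linked _≥_ (pre ++ y ∷ ws)
Linked-++-lower []            y≤x _           dec′ = dec′
Linked-++-lower (_ ∷ [])      y≤x (p≥x ∷ _)   dec′ = ≤-trans y≤x p≥x ∷ dec′
Linked-++-lower (_ ∷ q ∷ pre) y≤x (p≥q ∷ dec) dec′ = p≥q ∷ Linked-++-lower (q ∷ pre) y≤x dec dec′

Linked-at-tail : ∀ {x xs} → Linked _≥_ (x ∷ xs) → at xs 1 ≤ x
Linked-at-tail [-]       = z≤n
Linked-at-tail (x≥y ∷ _) = x≥y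

replicate-decreasing : ∀ m {a b} → a ≤ b → Linked _≥_ (b ∷ replicate m a)
replicate-decreasing zero    a≤b = [-]
replicate-decreasing (suc m) a≤b = a≤b ∷ replicate-decreasing m ≤-refl

sum-replicate-1 : ∀ m → sum (replicate m 1) ≡ m
sum-replicate-1 zero    = refl
sum-replicate-1 (suc m) = cong suc (sum-replicate-1 m)

positive-≤1⇒ones : ∀ {xs} → All (0 <_) xs → Linked _≥_ xs → at xs 1 ≤ 1 → xs ≡ replicate (length xs) 1
positive-≤1⇒ones []          _   _         = refl
positive-≤1⇒ones (s≤s _ ∷ pos) dec (s≤s z≤n) =
  cong (1 ∷_) (positive-≤1⇒ones pos (Linked.tail dec) (Linked-at-tail dec))

insertPart : ℕ → List ℕ → List ℕ
insertPart k []       = k ∷ []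
insertPart k (x ∷ xs) with k ≤? x
... | yes _ = x ∷ insertPart k xs
... | no  _ = k ∷ x ∷ xs

insertPart-length : ∀ k xs → length (insertPart k xs) ≡ suc (length xs)
insertPart-length k []       = refl
insertPart-length k (x ∷ xs) with k ≤? x
... | yes _ = cong suc (insertPart-length k xs)
... | no  _ = refl

insertPart-sum : ∀ k xs → sum (insertPart k xs) ≡ k + sum xs
insertPart-sum k []       = refl
insertPart-sum k (x ∷ xs) with k ≤? x
... | yes _ = trans (cong (x +_) (insertPart-sum k xs)) (x+[k+s]≡k+[x+s] x k (sum xs))
  where
  x+[k+s]≡k+[x+s] : ∀ x k s → x + (k + s) ≡ k + (x + s)
  x+[k+s]≡k+[x+s] = solve-∀
... | no  _ = refl

insertPart-positive : ∀ {k xs} → 0 < k → All (0 <_) xs → All (0 <_) (insertPart k xs)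
insertPart-positive {k} {[]}     k>0 []         = k>0 ∷ []
insertPart-positive {k} {x ∷ xs} k>0 (x>0 ∷ pos) with k ≤? x
... | yes _ = x>0 ∷ insertPart-positive k>0 pos
... | no  _ = k>0 ∷ x>0 ∷ pos

insertPart-decreasing : ∀ {k b} xs → k ≤ b → Linked _≥_ (b ∷ xs) → Linked _≥_ (b ∷ insertPart k xs)
insertPart-decreasing         []       k≤b _           = k≤b ∷ [-]
insertPart-decreasing {k} {b} (x ∷ xs) k≤b (b≥x ∷ dec) with k ≤? x
... | yes k≤x = b≥x ∷ insertPart-decreasing xs k≤x dec
... | no  k≰x = k≤b ∷ <⇒≤ (≰⇒> k≰x) ∷ dec

insertPart-head : ∀ k xs {y ys} → insertPart k xs ≡ y ∷ ys → k ≤ y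
insertPart-head k []       refl = ≤-refl
insertPart-head k (x ∷ xs) eq with k ≤? x
insertPart-head k (x ∷ xs) refl | yes k≤x = k≤x
insertPart-head k (x ∷ xs) refl | no  _   = ≤-refl

insertPart-injective : ∀ k xs ys → insertPart k xs ≡ insertPart k ys → xs ≡ ys
insertPart-injective k []       []       _  = refl
insertPart-injective k []       (y ∷ ys) eq with () ← suc-injective (trans (cong length eq) (insertPart-length k (y ∷ ys)))
insertPart-injective k (x ∷ xs) []       eq with () ← suc-injective (trans (cong length (sym eq)) (insertPart-length k (x ∷ xs)))
insertPart-injective k (x ∷ xs) (y ∷ ys) eq with k ≤? x | k ≤? y
... | yes _   | yes _   = cong₂ _∷_ (proj₁ (∷-injective eq)) (insertPart-injective k xs ys (∷-injectiveʳ eq))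
... | no  _   | no  _   = ∷-injectiveʳ eq
... | yes _   | no  k≰y with refl , eq′ ← ∷-injective eq = contradiction (insertPart-head k xs eq′) k≰y
... | no  k≰x | yes _   with refl , eq′ ← ∷-injective eq = contradiction (insertPart-head k ys (sym eq′)) k≰x

insertPart-∈ : ∀ k xs → k ∈ insertPart k xs
insertPart-∈ k []       = here refl
insertPart-∈ k (x ∷ xs) with k ≤? x
... | yes _ = there (insertPart-∈ k xs)
... | no  _ = here refl

at-applyUpTo : ∀ (f : ℕ → ℕ) m j → j < m → at (applyUpTo f m) (suc j) ≡ f j
at-applyUpTo f (suc m) zero    _         = refl
at-applyUpTo f (suc m) (suc j) (s≤s j<m) = at-applyUpTo (f ∘ suc) m j j<m

at-applyUpTo-≥ : ∀ (f : ℕ → ℕ) m j → m ≤ j → at (applyUpTo f m) (suc j) ≡ 0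
at-applyUpTo-≥ f zero    j       _         = refl
at-applyUpTo-≥ f (suc m) (suc j) (s≤s m≤j) = at-applyUpTo-≥ (f ∘ suc) m j m≤j

conj-length : ∀ μ → length (conj μ) ≡ at μ 1
conj-length μ = trans (length-map _ (upTo (at μ 1))) (length-upTo (at μ 1))

conj-at : ∀ μ j → j < at μ 1 → at (conj μ) (suc j) ≡ count≥ (suc j) μ
conj-at μ j j<μ₁ =
  trans (cong (λ ν → at ν (suc j)) (map-applyUpTo (λ i → i) _ (at μ 1))) (at-applyUpTo _ _ j j<μ₁)

conj-at-≥ : ∀ μ j → at μ 1 ≤ j → at (conj μ) (suc j) ≡ 0
conj-at-≥ μ j μ₁≤j =
  trans (cong (λ ν → at ν (suc j)) (map-applyUpTo (λ i → i) _ (at μ 1))) (at-applyUpTo-≥ _ _ j μ₁≤j)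

conj-at-≤count : ∀ μ j → at (conj μ) (suc j) ≤ count≥ (suc j) μ
conj-at-≤count μ j with j <? at μ 1
... | yes j<μ₁ = ≤-reflexive (conj-at μ j j<μ₁)
... | no  j≮μ₁ = ≤-trans (≤-reflexive (conj-at-≥ μ j (≮⇒≥ j≮μ₁))) z≤n

conj-at≡length⇒All : ∀ μ j → at (conj μ) (suc j) ≡ length μ → All (suc j ≤_) μ
conj-at≡length⇒All []          j _  = []
conj-at≡length⇒All μ@(m ∷ _) j eq with j <? m
... | yes j<m = subst (All (suc j ≤_)) (filter-complete (suc j ≤?_) (trans (sym (conj-at μ j j<m)) eq))
                      (all-filter (suc j ≤?_) μ)
... | no  j≮m = contradiction (trans (sym (conj-at-≥ μ j (≮⇒≥ j≮m))) eq) 0≢1+n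

All⇒conj-at≡length : ∀ μ j → All (suc j ≤_) μ → at (conj μ) (suc j) ≡ length μ
All⇒conj-at≡length []          j []            = refl
All⇒conj-at≡length μ@(_ ∷ _) j all@(j<m ∷ _) =
  trans (conj-at μ j j<m) (cong length (filter-all (suc j ≤?_) all))

durfeeFrom-stop : ∀ i rest → at rest 1 ≤ i → durfeeFrom i rest ≡ 0
durfeeFrom-stop i []         _   = refl
durfeeFrom-stop i (y ∷ rest) y≤i with suc i ≤? y
... | yes i<y = contradiction y≤i (<⇒≱ i<y)
... | no  _   = refl

durfeeFrom-∷ : ∀ {i x} xs → i < x → durfeeFrom i (x ∷ xs) ≡ suc (durfeeFrom (suc i) xs)
durfeeFrom-∷ {i} {x} xs i<x with suc i ≤? x
... | yes _   = refl
... | no  i≮x = contradiction i<x i≮x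

-- durfeeFrom i starts at row i + 1, so the last row of the square has index suc b.
durfeeFrom-square : ∀ i b pre {x rest} → length pre + i ≡ b → All (b <_) pre → b < x → at rest 1 ≤ suc b →
                    durfeeFrom i (pre ++ x ∷ rest) ≡ suc (length pre)
durfeeFrom-square i .i [] {rest = rest} refl [] i<x rest≤ =
  trans (durfeeFrom-∷ rest i<x) (cong suc (durfeeFrom-stop (suc i) rest rest≤))
durfeeFrom-square i b (p ∷ pre) {x} {rest} eq (b<p ∷ b<pre) b<x rest≤ =
  trans (durfeeFrom-∷ (pre ++ x ∷ rest) i<p)
        (cong suc (durfeeFrom-square (suc i) b pre (trans (+-suc (length pre) i) eq) b<pre b<x rest≤))
  where
  i<p : i < p
  i<p = ≤-trans (≤-trans (s≤s (m≤n+m i (length pre))) (≤-reflexive eq)) (<⇒≤ b<p)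

durfee-square : ∀ pre {x rest} → All (length pre <_) pre → length pre < x → at rest 1 ≤ suc (length pre) →
                durfee (pre ++ x ∷ rest) ≡ suc (length pre)
durfee-square pre = durfeeFrom-square 0 (length pre) pre (+-identityʳ (length pre))

alpha-square : ∀ pre x rest → durfee (pre ++ x ∷ rest) ≡ suc (length pre) →
               alpha (pre ++ x ∷ rest) ≡ conj (map (_∸ suc (length pre)) (pre ∷ʳ x))
alpha-square pre x rest dur rewrite dur | take-suc-length pre x rest = refl

beta-square : ∀ pre x rest → durfee (pre ++ x ∷ rest) ≡ suc (length pre) → beta (pre ++ x ∷ rest) ≡ rest
beta-square pre x rest dur rewrite dur = drop-suc-length pre x rest

alphaFor : ℕ → List ℕ → List ℕ
alphaFor d λs = conj (map (_∸ d) (take d λs))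

squareForm : ℕ → List ℕ → List ℕ → List ℕ
squareForm p ps rest = (p ∷ ps) ++ (2 + length ps) ∷ (2 + length ps) ∷ rest

squareForm-durfee : ∀ p ps rest → All (2 + length ps ≤_) (p ∷ ps) →
                    durfee (squareForm p ps rest) ≡ 2 + length ps
squareForm-durfee p ps rest rows = durfee-square (p ∷ ps) rows ≤-refl ≤-refl

squareForm-injective : ∀ {p ps rest p′ ps′ rest′} →
                       All (2 + length ps ≤_) (p ∷ ps) → All (2 + length ps′ ≤_) (p′ ∷ ps′) →
                       squareForm p ps rest ≡ squareForm p′ ps′ rest′ → p ∷ ps ≡ p′ ∷ ps′ × rest ≡ rest′
squareForm-injective {p} {ps} {rest} {p′} {ps′} {rest′} rows rows′ eq =
  map₂ (∷-injectiveʳ ∘ ∷-injectiveʳ) (++-cancel-length (p ∷ ps) (p′ ∷ ps′) sameSide eq)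
  where
  sameSide : suc (length ps) ≡ suc (length ps′)
  sameSide = suc-injective (begin
    2 + length ps                    ≡⟨ squareForm-durfee p ps rest rows ⟨
    durfee (squareForm p ps rest)    ≡⟨ cong durfee eq ⟩
    durfee (squareForm p′ ps′ rest′) ≡⟨ squareForm-durfee p′ ps′ rest′ rows′ ⟩
    2 + length ps′                   ∎)
    where open ≡-Reasoning

-- The last square row carries nothing to its right, so γ has a zero entry.
squareForm-U4 : ∀ p ps rest → All (2 + length ps ≤_) (p ∷ ps) → p ∸ (2 + length ps) ≡ length rest →
                InU4 (squareForm p ps rest)
squareForm-U4 p ps rest rows rank = (≤-trans (m≤m+n _ 1) (≤-reflexive lengths) , γ₁<d) , lengths , δ₁≡d
  where
  open ≡-Reasoning
  d = 2 + length ps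
  λs = squareForm p ps rest
  μ = map (_∸ d) ((p ∷ ps) ∷ʳ d)
  dur : durfee λs ≡ d
  dur = squareForm-durfee p ps rest rows
  α≡ : alpha λs ≡ conj μ
  α≡ = alpha-square (p ∷ ps) d (d ∷ rest) dur
  β≡ : beta λs ≡ d ∷ rest
  β≡ = beta-square (p ∷ ps) d (d ∷ rest) dur
  lengths : length (alpha λs) + 1 ≡ length (beta λs)
  lengths = begin
    length (alpha λs) + 1 ≡⟨ cong (λ α → length α + 1) α≡ ⟩
    length (conj μ) + 1   ≡⟨ cong (_+ 1) (trans (conj-length μ) rank) ⟩
    length rest + 1       ≡⟨ +-comm (length rest) 1 ⟩
    length (d ∷ rest)     ≡⟨ cong length β≡ ⟨
    length (beta λs)      ∎
  zero∈μ : Any (λ y → ¬ 1 ≤ y) μ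
  zero∈μ = Any.map⁺ (Any.++⁺ʳ (p ∷ ps) (here λ 1≤d∸d → contradiction (subst (1 ≤_) (n∸n≡0 d) 1≤d∸d) λ ()))
  count<d : count≥ 1 μ < d
  count<d = ≤-trans (filter-notAll (1 ≤?_) μ zero∈μ)
                    (≤-reflexive (trans (length-map _ ((p ∷ ps) ∷ʳ d)) (length-∷ʳ (p ∷ ps) d)))
  γ₁<d : at (alpha λs) 1 + 1 ≤ durfee λs
  γ₁<d rewrite α≡ | dur | +-comm (at (conj μ) 1) 1 = ≤-trans (s≤s (conj-at-≤count μ 0)) count<d
  δ₁≡d : at (beta λs) 1 ≡ durfee λs
  δ₁≡d = trans (cong (λ β → at β 1) β≡) (sym dur)

data P4Shape : List ℕ → Set where
  p4-shape : ∀ p ps post → p ∸ (2 + length ps) ≡ suc (length post) →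
             P4Shape ((p ∷ ps) ++ (4 + length ps) ∷ (2 + length ps) ∷ post)

-- α₂ = d says every row of the square overhangs by at least 2; α₃ < d says the bottom one by at most 2.
P4-bottomRow : ∀ pre x rest → Linked _≥_ (pre ++ x ∷ rest) →
               at (conj (map (_∸ suc (length pre)) (pre ∷ʳ x))) 2 ≡ suc (length pre) →
               at (conj (map (_∸ suc (length pre)) (pre ∷ʳ x))) 3 < suc (length pre) →
               x ≡ 2 + suc (length pre)
P4-bottomRow pre x rest dec α₂ α₃ = begin
  x         ≡⟨ m∸n+n≡m d≤x ⟨
  x ∸ d + d ≡⟨ cong (_+ d) (≤-antisym overhang≤2 2≤overhang) ⟩
  2 + d     ∎
  where
  open ≡-Reasoning
  d = suc (length pre)
  μ = map (_∸ d) (pre ∷ʳ x)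
  length-μ : length μ ≡ d
  length-μ = trans (length-map _ (pre ∷ʳ x)) (length-∷ʳ pre x)
  last : ∀ {P : ℕ → Set} → All P μ → P (x ∸ d)
  last all with Px ∷ [] ← ++⁻ʳ pre (map⁻ all) = Px
  2≤overhang : 2 ≤ x ∸ d
  2≤overhang = last (conj-at≡length⇒All μ 1 (trans α₂ (sym length-μ)))
  d≤x : d ≤ x
  d≤x = <⇒≤ (m∸n≢0⇒n<m λ eq → contradiction (subst (2 ≤_) eq 2≤overhang) λ ())
  overhang≤2 : x ∸ d ≤ 2
  overhang≤2 = ≮⇒≥ λ 3≤overhang → <-irrefl (trans (All⇒conj-at≡length μ 2 (all≥3 3≤overhang)) length-μ) α₃
    where
    all≥3 : 3 ≤ x ∸ d → All (3 ≤_) μ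
    all≥3 3≤ = map⁺ (++⁺ (All.map (λ x≤y → ≤-trans 3≤ (∸-monoˡ-≤ d x≤y)) (Linked-++⇒All≥ pre dec)) (3≤ ∷ []))

P4-side1-sum≤5 : ∀ post → Linked _≥_ (3 ∷ 1 ∷ post) → 2 ≡ suc (length post) → sum (3 ∷ 1 ∷ post) ≤ 5
P4-side1-sum≤5 (z ∷ []) (_ ∷ z≤1 ∷ [-]) refl = +-monoʳ-≤ 4 (+-monoˡ-≤ 0 z≤1)

P4Shape-intro : ∀ pre x post → Linked _≥_ (pre ++ x ∷ suc (length pre) ∷ post) →
                6 ≤ sum (pre ++ x ∷ suc (length pre) ∷ post) →
                length (conj (map (_∸ suc (length pre)) (pre ∷ʳ x))) ≡ suc (length post) →
                at (conj (map (_∸ suc (length pre)) (pre ∷ʳ x))) 2 ≡ suc (length pre) →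
                at (conj (map (_∸ suc (length pre)) (pre ∷ʳ x))) 3 < suc (length pre) →
                P4Shape (pre ++ x ∷ suc (length pre) ∷ post)
P4Shape-intro pre x post dec big rank α₂ α₃ with P4-bottomRow pre x _ dec α₂ α₃
P4Shape-intro []       _ post dec big rank _ _ | refl = contradiction (≤-trans big (P4-side1-sum≤5 post dec rank)) 1+n≰n
P4Shape-intro (p ∷ ps) _ post _   _   rank _ _ | refl =
  p4-shape p ps post (trans (sym (conj-length (map (_∸ (2 + length ps)) ((p ∷ ps) ∷ʳ (4 + length ps))))) rank)

P4Shape-from : ∀ d λs → Linked _≥_ λs → 6 ≤ sum λs →
               length (alphaFor d λs) ≡ length (drop d λs) → at (drop d λs) 1 ≡ d →
               at (alphaFor d λs) 2 ≡ d → at (alphaFor d λs) 3 < d → P4Shape λs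
P4Shape-from zero    λs _   _   _    _  _  ()
P4Shape-from (suc e) λs dec big rank β₁ α₂ α₃ with drop (suc e) λs in below
... | []       = contradiction β₁ 0≢1+n
... | y ∷ post with refl ← β₁ with pre , x , refl , refl ← drop-suc-view e λs below
  rewrite take-suc-length pre x (suc (length pre) ∷ post) = P4Shape-intro pre x post dec big rank α₂ α₃

image4 : ∀ {λs} → P4Shape λs → List ℕ
image4 (p4-shape p ps post _) = squareForm p ps (insertPart 2 post)

P4-upperRows : ∀ p ps {post} → Linked _≥_ ((p ∷ ps) ++ (4 + length ps) ∷ (2 + length ps) ∷ post) →
               All (2 + length ps ≤_) (p ∷ ps)
P4-upperRows p ps dec = All.map (≤-trans (m≤n+m _ 2)) (Linked-++⇒All≥ (p ∷ ps) dec)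

image4-positive : ∀ {λs} (D : P4Shape λs) → All (0 <_) λs → All (0 <_) (image4 D)
image4-positive (p4-shape p ps post _) pos with above , _ ∷ d>0 ∷ below ← ++⁻ (p ∷ ps) pos =
  ++⁺ above (d>0 ∷ d>0 ∷ insertPart-positive (s≤s z≤n) below)

image4-decreasing : ∀ {λs} (D : P4Shape λs) → Linked _≥_ λs → Linked _≥_ (image4 D)
image4-decreasing (p4-shape p ps post _) dec =
  Linked-++-lower (p ∷ ps) (m≤n+m _ 2) dec
    (≤-refl ∷ insertPart-decreasing post (m≤m+n 2 _) (Linked.tail (Linked-++⁻ʳ (p ∷ ps) dec)))

image4-sum : ∀ {λs} (D : P4Shape λs) → sum (image4 D) ≡ sum λs
image4-sum (p4-shape p ps post _) = begin
  sum ((p ∷ ps) ++ d ∷ d ∷ insertPart 2 post)        ≡⟨ sum-++ (p ∷ ps) _ ⟩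
  sum (p ∷ ps) + (d + (d + sum (insertPart 2 post))) ≡⟨ cong (λ s → sum (p ∷ ps) + (d + (d + s))) (insertPart-sum 2 post) ⟩
  sum (p ∷ ps) + (d + (d + (2 + sum post)))          ≡⟨ cong (sum (p ∷ ps) +_) (shift d (sum post)) ⟩
  sum (p ∷ ps) + ((2 + d) + (d + sum post))          ≡⟨ sum-++ (p ∷ ps) _ ⟨
  sum ((p ∷ ps) ++ (2 + d) ∷ d ∷ post)               ∎
  where
  open ≡-Reasoning
  d = 2 + length ps
  shift : ∀ d s → d + (d + (2 + s)) ≡ (2 + d) + (d + s)
  shift = solve-∀

image4-U4 : ∀ {λs} (D : P4Shape λs) → Linked _≥_ λs → InU4 (image4 D)
image4-U4 (p4-shape p ps post rank) dec =
  squareForm-U4 p ps _ (P4-upperRows p ps dec) (trans rank (sym (insertPart-length 2 post)))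

image4-injective : ∀ {λs λs′} (D : P4Shape λs) (D′ : P4Shape λs′) → Linked _≥_ λs → Linked _≥_ λs′ →
                   image4 D ≡ image4 D′ → λs ≡ λs′
image4-injective (p4-shape p ps post _) (p4-shape p′ ps′ post′ _) dec dec′ eq
  with refl , rest≡ ← squareForm-injective (P4-upperRows p ps dec) (P4-upperRows p′ ps′ dec′) eq
  with refl ← insertPart-injective 2 post post′ rest≡ = refl

2∈image4 : ∀ {λs} (D : P4Shape λs) → 2 ∈ image4 D
2∈image4 (p4-shape p ps post _) = ∈-++⁺ʳ (p ∷ ps) (there (there (insertPart-∈ 2 post)))

data P7Shape : List ℕ → Set where
  p7-shape : ∀ {m c} → c < m → P7Shape ((4 + m) ∷ (5 + c) ∷ 2 ∷ replicate (suc m) 1)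

P7Shape-intro : ∀ a x k → a ∸ 2 ≡ suc k → 3 ≤ x ∸ 2 → x ≤ a → P7Shape (a ∷ x ∷ 2 ∷ replicate k 1)
P7Shape-intro zero          _             _       ()   _                   _
P7Shape-intro (suc zero)    _             _       ()   _                   _
P7Shape-intro (suc (suc _)) zero          _       _    ()                  _
P7Shape-intro (suc (suc _)) (suc zero)    _       _    ()                  _
P7Shape-intro (suc (suc _)) (suc (suc _)) zero    refl (s≤s (s≤s (s≤s _))) (s≤s (s≤s (s≤s ())))
P7Shape-intro (suc (suc _)) (suc (suc _)) (suc m) refl (s≤s (s≤s (s≤s _))) (s≤s (s≤s (s≤s (s≤s c<m)))) = p7-shape c<m

P7Shape-from : ∀ d λs → All (0 <_) λs → Linked _≥_ λs →
               length (alphaFor d λs) ≡ length (drop d λs) → d ≡ 2 →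
               at (drop d λs) 1 ≡ 2 → at (drop d λs) 2 < 2 → at (alphaFor d λs) 3 ≡ 2 → P7Shape λs
P7Shape-from _ []          _ _ _ refl () _ _
P7Shape-from _ (_ ∷ [])     _ _ _ refl () _ _
P7Shape-from _ (_ ∷ _ ∷ []) _ _ _ refl () _ _
P7Shape-from _ (a ∷ x ∷ _ ∷ post) (_ ∷ _ ∷ _ ∷ pos) (a≥x ∷ _ ∷ dec) rank refl refl β₂ α₃
  with _ ∷ 3≤x∸2 ∷ [] ← conj-at≡length⇒All (a ∸ 2 ∷ x ∸ 2 ∷ []) 2 α₃ =
  subst (λ ones → P7Shape (a ∷ x ∷ 2 ∷ ones)) (sym (positive-≤1⇒ones pos (Linked.tail dec) (≤-pred β₂)))
        (P7Shape-intro a x (length post) (trans (sym (conj-length (a ∸ 2 ∷ x ∸ 2 ∷ []))) rank) 3≤x∸2 a≥x)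

image7 : ∀ {λs} → P7Shape λs → List ℕ
image7 (p7-shape {m} {c} _) = squareForm (3 + m) (3 + c ∷ []) (replicate m 1)

P7-upperRows : ∀ m c → All (3 ≤_) (3 + m ∷ 3 + c ∷ [])
P7-upperRows m c = m≤m+n 3 m ∷ m≤m+n 3 c ∷ []

image7-positive : ∀ {λs} (E : P7Shape λs) → All (0 <_) (image7 E)
image7-positive (p7-shape {m} _) = s≤s z≤n ∷ s≤s z≤n ∷ s≤s z≤n ∷ s≤s z≤n ∷ replicate⁺ m (s≤s z≤n)

image7-decreasing : ∀ {λs} (E : P7Shape λs) → Linked _≥_ (image7 E)
image7-decreasing (p7-shape {m} {c} c<m) =
  +-monoʳ-≤ 3 (<⇒≤ c<m) ∷ m≤m+n 3 c ∷ ≤-refl ∷ replicate-decreasing m (s≤s z≤n)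

image7-sum : ∀ {λs} (E : P7Shape λs) → sum (image7 E) ≡ sum λs
image7-sum (p7-shape {m} {c} _) = begin
  (3 + m) + ((3 + c) + (3 + (3 + sum (replicate m 1))))   ≡⟨ cong (λ s → (3 + m) + ((3 + c) + (3 + (3 + s)))) (sum-replicate-1 m) ⟩
  (3 + m) + ((3 + c) + (3 + (3 + m)))                     ≡⟨ rearrange m c ⟩
  (4 + m) + ((5 + c) + (2 + suc m))                       ≡⟨ cong (λ s → (4 + m) + ((5 + c) + (2 + s))) (sum-replicate-1 (suc m)) ⟨
  (4 + m) + ((5 + c) + (2 + sum (replicate (suc m) 1))) ∎
  where
  open ≡-Reasoning
  rearrange : ∀ m c → (3 + m) + ((3 + c) + (3 + (3 + m))) ≡ (4 + m) + ((5 + c) + (2 + suc m))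
  rearrange = solve-∀

image7-U4 : ∀ {λs} (E : P7Shape λs) → InU4 (image7 E)
image7-U4 (p7-shape {m} {c} _) = squareForm-U4 (3 + m) (3 + c ∷ []) (replicate m 1) (P7-upperRows m c) (sym (length-replicate m))

image7-injective : ∀ {λs λs′} (E : P7Shape λs) (E′ : P7Shape λs′) → image7 E ≡ image7 E′ → λs ≡ λs′
image7-injective (p7-shape _) (p7-shape _) refl = refl

2∉image7 : ∀ {λs} (E : P7Shape λs) → 2 ∉ image7 E
2∉image7 (p7-shape {m} _) = All¬⇒¬Any ((λ ()) ∷ (λ ()) ∷ (λ ()) ∷ (λ ()) ∷ replicate⁺ m (λ ()))

fromP4 : ∀ {n} (P : Partition n) → P4Shape (parts P) → U4 n
fromP4 P D =
  mkPartition (image4 D) (image4-positive D (positive P)) (image4-decreasing D (decr P)) (trans (image4-sum D) (total P))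
  , image4-U4 D (decr P)

fromP7 : ∀ {n} (P : Partition n) → P7Shape (parts P) → U4 n
fromP7 P E = mkPartition (image7 E) (image7-positive E) (image7-decreasing E) (trans (image7-sum E) (total P)) , image7-U4 E

lemma4p6 : ∀ (n : ℕ) → n ≥ 6 → Injection n
lemma4p6 n n≥6 = f , f-injective
  where
  shape4 : (P : Partition n) → InP4 (parts P) → P4Shape (parts P)
  shape4 P (rank , β₁ , _ , α₂ , α₃) =
    P4Shape-from (durfee (parts P)) (parts P) (decr P) (subst (6 ≤_) (sym (total P)) n≥6) rank β₁ α₂ α₃

  shape7 : (P : Partition n) → InP7 (parts P) → P7Shape (parts P)
  shape7 P (rank , d≡2 , β₁ , β₂ , _ , _ , α₃) =
    P7Shape-from (durfee (parts P)) (parts P) (positive P) (decr P) rank d≡2 β₁ β₂ α₃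

  f : P4∪P7 n → U4 n
  f (P , inj₁ p4) = fromP4 P (shape4 P p4)
  f (P , inj₂ p7) = fromP7 P (shape7 P p7)

  f-injective : ∀ x y → parts (proj₁ (f x)) ≡ parts (proj₁ (f y)) → parts (proj₁ x) ≡ parts (proj₁ y)
  f-injective (P , inj₁ p) (Q , inj₁ q) = image4-injective (shape4 P p) (shape4 Q q) (decr P) (decr Q)
  f-injective (P , inj₂ p) (Q , inj₂ q) = image7-injective (shape7 P p) (shape7 Q q)
  f-injective (P , inj₁ p) (Q , inj₂ q) eq = ⊥-elim (2∉image7 (shape7 Q q) (subst (2 ∈_) eq (2∈image4 (shape4 P p))))
  f-injective (P , inj₂ p) (Q , inj₁ q) eq = ⊥-elim (2∉image7 (shape7 P p) (subst (2 ∈_) (sym eq) (2∈image4 (shape4 Q q))))
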